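{- Let $p$ be a prime, $G=C_p\times C_p$ (written additively), $I=\{1,2,3,4\}$. Let $G_{ij}\le G$ ($i,j\in I$) be subgroups with $|G_{ij}|=p$ for $i\ne j$, $G_{ii}=0$, and $G_{ij}\ne G_{ik}$ whenever $j\ne k$. Let $f_{ij}:G/G_{ij}\to G/G_{ji}$ be group isomorphisms with $f_{ii}=\mathrm{id}$ and $f_{ij}=f_{ji}^{ -1}$. Let $\mathcal X=(\Omega,S)$ be the coherent configuration on the disjoint union $\Omega$ of four copies $\Omega_1,\dots,\Omega_4$ of $G$ whose basis relations are the sets $r_{ij}(x)=\{(\alpha,\beta)\in\Omega_i\times\Omega_j:\ \beta+G_{ji}=f_{ij}(x+\alpha+G_{ij})\}$, $i,j\in I$, $x\in G$. For distinct $a,i,j\in I$ (so that $G=G_{ia}\oplus G_{ij}=G_{ja}\oplus G_{ji}$) let $\sigma_{ija}:G_{ia}\to G_{ja}$ be the unique isomorphism with $f_{ij}(x+G_{ij})=\sigma_{ija}(x)+G_{ji}$ for all $x\in G_{ia}$. If $\mathcal X$ is schurian, then $\sigma_{kia}(\sigma_{jka}(\sigma_{ija}(x)))=x$ for all $x\in G_{ia}$ and all $i,j,k,a$ with $\{i,j,k,a\}=\{1,2,3,4\}$.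
   Context: Under these hypotheses the data form a system of linked quotients and the described pair $\mathcal X$ is a quasiregular coherent configuration with fibers $\Omega_1,\dots,\Omega_4$. A coherent configuration is a pair $(\Omega,S)$ with $S$ a partition of $\Omega\times\Omega$ such that $1_\Omega$ is a union of elements of $S$, $S$ is closed under transposition, and for $r,s,t\in S$ the number $|\{\gamma:(\alpha,\gamma)\in r,(\gamma,\beta)\in s\}|$ is independent of $(\alpha,\beta)\in t$. It is schurian if $S$ is the set of orbits on $\Omega\times\Omega$ of some permutation group on $\Omega$. -}

module Defs where

open import Data.Nat using (ℕ; NonZero; _+_; _∸_)
open import Data.Nat.DivMod using (_mod_)
open import Data.Fin using (Fin; toℕ; zero)
open import Data.Bool using (Bool; true)
open import Data.List using (List; length; filterᵇ; cartesianProduct; allFin)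
open import Data.Product using (_×_; _,_; Σ; ∃; proj₁; proj₂)
open import Relation.Binary.PropositionalEquality using (_≡_)
open import Relation.Nullary using (¬_)
open import Function using (_∘_; id)
open import Function.Bundles using (_⇔_)

module _ (p : ℕ) .{{_ : NonZero p}} where

  G : Set
  G = Fin p × Fin p

  infixl 6 _⊕_ _⊖_

  _⊕_ : G → G → G
  (a , b) ⊕ (c , d) = ((toℕ a + toℕ c) mod p) , ((toℕ b + toℕ d) mod p)

  ⊝_ : G → G
  ⊝ (a , b) = ((p ∸ toℕ a) mod p) , ((p ∸ toℕ b) mod p)

  _⊖_ : G → G → G
  x ⊖ y = x ⊕ (⊝ y)

  0G : G
  0G = (0 mod p) , (0 mod p)

  allG : List G
  allG = cartesianProduct (allFin p) (allFin p)

  Subset : Set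
  Subset = G → Bool

  _∈_ : G → Subset → Set
  x ∈ H = H x ≡ true

  card : Subset → ℕ
  card H = length (filterᵇ H allG)

  record IsSubgroup (H : Subset) : Set where
    field
      has-0 : 0G ∈ H
      ⊕-closed : ∀ x y → x ∈ H → y ∈ H → (x ⊕ y) ∈ H
      ⊝-closed : ∀ x → x ∈ H → (⊝ x) ∈ H

  -- x + H = y + H  (equality of cosets of H, elements of G/H given by representatives)
  CosEq : Subset → G → G → Set
  CosEq H x y = (x ⊖ y) ∈ H

  Idx : Set
  Idx = Fin 4

  -- The data: subgroups G_ij and group isomorphisms f_ij : G/G_ij → G/G_ji.
  -- f i j is a map on representatives: (f i j x) + G_ji = f_ij (x + G_ij).
  record LinkedData : Set where
    field
      Gs : Idx → Idx → Subset
      f  : Idx → Idx → G → G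
      Gs-subgroup : ∀ i j → IsSubgroup (Gs i j)
      Gs-order : ∀ i j → ¬ i ≡ j → card (Gs i j) ≡ p
      Gs-diag : ∀ i x → x ∈ Gs i i ⇔ x ≡ 0G
      Gs-distinct : ∀ i j k → ¬ j ≡ k → ¬ (∀ x → Gs i j x ≡ Gs i k x)
      f-wd : ∀ i j x y → CosEq (Gs i j) x y → CosEq (Gs j i) (f i j x) (f i j y)
      f-hom : ∀ i j x y → CosEq (Gs j i) (f i j (x ⊕ y)) (f i j x ⊕ f i j y)
      f-inj : ∀ i j x y → CosEq (Gs j i) (f i j x) (f i j y) → CosEq (Gs i j) x y
      f-surj : ∀ i j y → ∃ λ x → CosEq (Gs j i) (f i j x) y
      f-diag : ∀ i x → CosEq (Gs i i) (f i i x) x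
      f-inv : ∀ i j x → CosEq (Gs i j) (f j i (f i j x)) x

  module _ (D : LinkedData) where
    open LinkedData D

    Ω : Set
    Ω = Idx × G

    InR : Idx → Idx → G → Ω → Ω → Set
    InR i j x (i' , α) (j' , β) =
      i' ≡ i × j' ≡ j × CosEq (Gs j i) β (f i j (x ⊕ α))

    SameBasis : Ω → Ω → Ω → Ω → Set
    SameBasis u v u' v' =
      Σ Idx λ i → Σ Idx λ j → Σ G λ x → InR i j x u v × InR i j x u' v'

    record IsPermGroup (K : (Ω → Ω) → Set) : Set where
      field
        has-id : K id
        ∘-closed : ∀ g h → K g → K h → K (g ∘ h)
        inverse : ∀ g → K g → Σ (Ω → Ω) λ h →
                    K h × (∀ u → g (h u) ≡ u) × (∀ u → h (g u) ≡ u)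

    -- X is schurian: S is the set of orbits of some permutation group K on Ω × Ω,
    -- i.e. two pairs lie in the same K-orbit iff they lie in the same basis relation.
    Schurian : Set₁
    Schurian = Σ ((Ω → Ω) → Set) λ K → IsPermGroup K ×
      (∀ u v u' v' → (Σ (Ω → Ω) λ g → K g × g u ≡ u' × g v ≡ v') ⇔ SameBasis u v u' v')

    IsSigma : Idx → Idx → Idx → G → G → Set
    IsSigma i j a x y = x ∈ Gs i a × y ∈ Gs j a × CosEq (Gs j i) (f i j x) y

Distinct4 : Fin 4 → Fin 4 → Fin 4 → Fin 4 → Set
Distinct4 i j k a = ¬ i ≡ j × ¬ i ≡ k × ¬ i ≡ a × ¬ j ≡ k × ¬ j ≡ a × ¬ k ≡ a

module Submission where

open import Defs
open import Data.Nat using (ℕ; NonZero)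
open import Data.Nat.Primality using (Prime)
open import Relation.Binary.PropositionalEquality using (_≡_)

open import Level using (0ℓ)
open import Algebra.Bundles using (AbelianGroup)
open import Data.Bool using (true; false)
open import Data.Bool.Properties using (T-≡; ⇔→≡)
open import Data.Fin as Fin using (Fin; toℕ)
open import Data.Fin.Properties using (toℕ-fromℕ<; toℕ-injective; toℕ<n; injective⇒≤)
open import Data.List using (filterᵇ)
open import Data.List.Membership.Propositional using () renaming (_∈_ to _∈ˡ_)
open import Data.List.Membership.Propositional.Properties
  using (∈-filter⁺; ∈-cartesianProduct⁺; ∈-allFin)
open import Data.List.Membership.Setoid.Properties using (index-injective)
open import Data.List.Relation.Unary.Any using (index)
open import Data.Nat as ℕ using (zero; suc; _∸_; _%_; _<_; _≤_; z<s)
open import Data.Nat.DivMod using (_mod_; m%n<n; m%n%n≡m%n; %-distribˡ-+; m<n⇒m%n≡m; n%n≡0)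
open import Data.Nat.Divisibility using (_∣_; m%n≡0⇒n∣m; >⇒∤)
open import Data.Nat.Primality using (euclidsLemma)
open import Data.Nat.Properties
  using (+-comm; +-assoc; +-identityʳ; m+[n∸m]≡n; m≤n⇒∃[o]m+o≡n; <⇒≤; m≤n+m; ≤-<-trans; ≤-total; 1+n≰n)
open import Data.Product using (Σ; _×_; _,_; proj₁; proj₂)
open import Data.Product.Properties using (≡-dec)
open import Data.Sum using (inj₁; inj₂)
open import Function using (_∘_)
open import Function.Bundles using (_⇔_; mk⇔; Equivalence)
open import Function.Definitions using (Injective)
open import Relation.Binary.Bundles using (Setoid)
open import Relation.Binary.PropositionalEquality
  using (refl; sym; trans; cong; cong₂; subst; isEquivalence; _≢_; module ≡-Reasoning)
import Relation.Binary.PropositionalEquality as ≡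
import Relation.Binary.Reasoning.Setoid as SetoidReasoning
open import Relation.Nullary using (¬_; Dec; yes; no; contradiction)
open import Relation.Nullary.Decidable using (T?)

-- Fix x ∈ G_ia.  The pairs ((i,0),(a,0)) and ((i,x),(a,0)) lie in the same
-- basis relation r_ia(s), where s is any element with f_ia(s + G_ia) = G_ai.
-- If X is schurian, some g in the group K maps the first pair onto the second.
-- Write g(m,0) = (m, t_m).  Since g preserves every basis relation r_mn(·),
-- the displacements satisfy t_n ≡ f_mn(t_m) modulo G_nm.  As t_a = 0 this puts
-- t_n in G_na; so t_n - σ_mna(t_m) lies in G_nm ∩ G_na, which is trivial:
-- two distinct subgroups of order p of C_p × C_p meet in 0.  So t_n = σ_mna(t_m), and going once around i → j → k → i starting
-- from t_i = x returns σ_kia(σ_jka(σ_ija(x))) = t_i = x.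

module _ (p : ℕ) .{{_ : NonZero p}} where

  infixl 6 _+ₚ_

  _+ₚ_ : Fin p → Fin p → Fin p
  a +ₚ b = (toℕ a ℕ.+ toℕ b) mod p

  -ₚ_ : Fin p → Fin p
  -ₚ a = (p ∸ toℕ a) mod p

  0ₚ : Fin p
  0ₚ = 0 mod p

  toℕ-mod : ∀ n → toℕ (n mod p) ≡ n % p
  toℕ-mod n = toℕ-fromℕ< (m%n<n n p)

  0%p≡0 : 0 % p ≡ 0
  0%p≡0 = m<n⇒m%n≡m (ℕ.>-nonZero⁻¹ p)

  toℕ-0ₚ : toℕ 0ₚ ≡ 0
  toℕ-0ₚ = trans (toℕ-mod 0) 0%p≡0

  %-absorbʳ : ∀ m n → (m ℕ.+ n % p) % p ≡ (m ℕ.+ n) % p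
  %-absorbʳ m n = begin
    (m ℕ.+ n % p) % p           ≡⟨ %-distribˡ-+ m (n % p) p ⟩
    (m % p ℕ.+ n % p % p) % p   ≡⟨ cong (λ k → (m % p ℕ.+ k) % p) (m%n%n≡m%n n p) ⟩
    (m % p ℕ.+ n % p) % p       ≡⟨ %-distribˡ-+ m n p ⟨
    (m ℕ.+ n) % p               ∎
    where open ≡-Reasoning

  +ₚ-comm : ∀ a b → a +ₚ b ≡ b +ₚ a
  +ₚ-comm a b = cong (_mod p) (+-comm (toℕ a) (toℕ b))

  toℕ-+ₚ-+ₚ : ∀ a b c → toℕ (a +ₚ (b +ₚ c)) ≡ (toℕ a ℕ.+ (toℕ b ℕ.+ toℕ c)) % p
  toℕ-+ₚ-+ₚ a b c =
    trans (toℕ-mod _) (trans (cong (λ k → (toℕ a ℕ.+ k) % p) (toℕ-mod _)) (%-absorbʳ _ _))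

  -- After commuting, both sides are nested sums with the same total.
  +ₚ-assoc : ∀ a b c → (a +ₚ b) +ₚ c ≡ a +ₚ (b +ₚ c)
  +ₚ-assoc a b c = trans (+ₚ-comm (a +ₚ b) c) (toℕ-injective (begin
    toℕ (c +ₚ (a +ₚ b))                     ≡⟨ toℕ-+ₚ-+ₚ c a b ⟩
    (toℕ c ℕ.+ (toℕ a ℕ.+ toℕ b)) % p       ≡⟨ cong (_% p) (trans (+-comm (toℕ c) _) (+-assoc (toℕ a) _ _)) ⟩
    (toℕ a ℕ.+ (toℕ b ℕ.+ toℕ c)) % p       ≡⟨ toℕ-+ₚ-+ₚ a b c ⟨
    toℕ (a +ₚ (b +ₚ c))                     ∎))
    where open ≡-Reasoning

  +ₚ-identityˡ : ∀ a → 0ₚ +ₚ a ≡ a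
  +ₚ-identityˡ a = toℕ-injective (begin
    toℕ (0ₚ +ₚ a)              ≡⟨ toℕ-mod _ ⟩
    (toℕ 0ₚ ℕ.+ toℕ a) % p     ≡⟨ cong (λ k → (k ℕ.+ toℕ a) % p) toℕ-0ₚ ⟩
    toℕ a % p                  ≡⟨ m<n⇒m%n≡m (toℕ<n a) ⟩
    toℕ a                      ∎)
    where open ≡-Reasoning

  +ₚ-inverseʳ : ∀ a → a +ₚ (-ₚ a) ≡ 0ₚ
  +ₚ-inverseʳ a = toℕ-injective (begin
    toℕ (a +ₚ (-ₚ a))                  ≡⟨ toℕ-mod _ ⟩
    (toℕ a ℕ.+ toℕ (-ₚ a)) % p         ≡⟨ cong (λ k → (toℕ a ℕ.+ k) % p) (toℕ-mod _) ⟩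
    (toℕ a ℕ.+ (p ∸ toℕ a) % p) % p    ≡⟨ %-absorbʳ _ _ ⟩
    (toℕ a ℕ.+ (p ∸ toℕ a)) % p        ≡⟨ cong (_% p) (m+[n∸m]≡n (<⇒≤ (toℕ<n a))) ⟩
    p % p                              ≡⟨ n%n≡0 p ⟩
    0                                  ≡⟨ toℕ-0ₚ ⟨
    toℕ 0ₚ                             ∎)
    where open ≡-Reasoning

  G-abelianGroup : AbelianGroup 0ℓ 0ℓ
  G-abelianGroup = record
    { Carrier = G p ; _≈_ = _≡_ ; _∙_ = _⊕_ p ; ε = 0G p ; _⁻¹ = ⊝_ p
    ; isAbelianGroup = record
      { isGroup = record
        { isMonoid = record
          { isSemigroup = record
            { isMagma = record { isEquivalence = isEquivalence ; ∙-cong = cong₂ (_⊕_ p) }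
            ; assoc = λ x y z → cong₂ _,_ (+ₚ-assoc _ _ _) (+ₚ-assoc _ _ _)
            }
          ; identity = identityˡ , λ x → trans (comm x (0G p)) (identityˡ x)
          }
        ; inverse = (λ x → trans (comm (⊝_ p x) x) (inverseʳ x)) , inverseʳ
        ; ⁻¹-cong = cong (⊝_ p)
        }
      ; comm = comm
      }
    }
    where
    comm : ∀ x y → _⊕_ p x y ≡ _⊕_ p y x
    comm (a , b) (c , d) = cong₂ _,_ (+ₚ-comm a c) (+ₚ-comm b d)
    identityˡ : ∀ x → _⊕_ p (0G p) x ≡ x
    identityˡ x = cong₂ _,_ (+ₚ-identityˡ _) (+ₚ-identityˡ _)
    inverseʳ : ∀ x → _⊕_ p x (⊝_ p x) ≡ 0G p
    inverseʳ x = cong₂ _,_ (+ₚ-inverseʳ _) (+ₚ-inverseʳ _)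

  open AbelianGroup G-abelianGroup
    using (_∙_; ε; _⁻¹; _-_; assoc; identityˡ; identityʳ; inverseʳ; commutativeSemigroup; monoid)
  open import Algebra.Properties.AbelianGroup G-abelianGroup
    using (⁻¹-anti-homo-//; ⁻¹-∙-comm; \\-leftDividesʳ; identityʳ-unique; x∙y⁻¹≈ε⇒x≈y; ε⁻¹≈ε)
  open import Algebra.Properties.CommutativeSemigroup commutativeSemigroup using (interchange)
  open import Algebra.Properties.Monoid.Mult monoid using (×-homo-+) renaming (_×_ to _·_)

  _≟_ : (x y : G p) → Dec (x ≡ y)
  _≟_ = ≡-dec Fin._≟_ Fin._≟_

  infix 4 _∈ₛ_ _≈[_]_

  _∈ₛ_ : G p → Subset p → Set
  _∈ₛ_ = _∈_ p

  _≈[_]_ : G p → Subset p → G p → Set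
  x ≈[ H ] y = CosEq p H x y

  toℕ-π-· : (π : G p → Fin p) → (∀ x y → π (x ∙ y) ≡ π x +ₚ π y) → π ε ≡ 0ₚ →
            ∀ n v → toℕ (π (n · v)) ≡ (n ℕ.* toℕ (π v)) % p
  toℕ-π-· π π-∙ π-ε zero v = trans (cong toℕ π-ε) (trans toℕ-0ₚ (sym 0%p≡0))
  toℕ-π-· π π-∙ π-ε (suc n) v = begin
    toℕ (π (v ∙ n · v))                              ≡⟨ cong toℕ (π-∙ v (n · v)) ⟩
    toℕ (π v +ₚ π (n · v))                           ≡⟨ toℕ-mod _ ⟩
    (toℕ (π v) ℕ.+ toℕ (π (n · v))) % p              ≡⟨ cong (λ k → (toℕ (π v) ℕ.+ k) % p) (toℕ-π-· π π-∙ π-ε n v) ⟩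
    (toℕ (π v) ℕ.+ (n ℕ.* toℕ (π v)) % p) % p        ≡⟨ %-absorbʳ _ _ ⟩
    (suc n ℕ.* toℕ (π v)) % p                        ∎
    where open ≡-Reasoning

  prime-∣-product : Prime p → ∀ d c → 0 < d → d < p → c < p → (d ℕ.* c) % p ≡ 0 → c ≡ 0
  prime-∣-product pr (suc d) c _ d<p c<p dc≡0 with euclidsLemma (suc d) c pr (m%n≡0⇒n∣m _ p dc≡0)
  ... | inj₁ p∣d = contradiction p∣d (>⇒∤ d<p)
  ... | inj₂ p∣c = below-p c c<p p∣c
    where
    below-p : ∀ c → c < p → p ∣ c → c ≡ 0
    below-p zero    _   _   = refl
    below-p (suc c) c<p p∣c = contradiction p∣c (>⇒∤ c<p)

  ·-torsionFree : Prime p → ∀ d v → 0 < d → d < p → d · v ≡ ε → v ≡ ε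
  ·-torsionFree pr d v 0<d d<p dv≡ε =
    cong₂ _,_ (coordinate-zero proj₁ (λ _ _ → refl) refl) (coordinate-zero proj₂ (λ _ _ → refl) refl)
    where
    coordinate-zero : (π : G p → Fin p) → (∀ x y → π (x ∙ y) ≡ π x +ₚ π y) → π ε ≡ 0ₚ → π v ≡ 0ₚ
    coordinate-zero π π-∙ π-ε = toℕ-injective (trans
      (prime-∣-product pr d (toℕ (π v)) 0<d d<p (toℕ<n (π v)) (begin
        (d ℕ.* toℕ (π v)) % p   ≡⟨ toℕ-π-· π π-∙ π-ε d v ⟨
        toℕ (π (d · v))         ≡⟨ cong (toℕ ∘ π) dv≡ε ⟩
        toℕ (π ε)               ≡⟨ cong toℕ π-ε ⟩
        toℕ 0ₚ                  ≡⟨ toℕ-0ₚ ⟩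
        0                       ∎))
      (sym toℕ-0ₚ))
      where open ≡-Reasoning

  ·-gap : Prime p → ∀ v → v ≢ ε → ∀ m d → m ℕ.+ d < p → m · v ≡ (m ℕ.+ d) · v → m ≡ m ℕ.+ d
  ·-gap pr v v≢ε m zero    _     _  = sym (+-identityʳ m)
  ·-gap pr v v≢ε m (suc d) m+d<p eq = contradiction
    (·-torsionFree pr (suc d) v z<s (≤-<-trans (m≤n+m (suc d) m) m+d<p)
      (identityʳ-unique (m · v) (suc d · v) (sym (trans eq (×-homo-+ v m (suc d))))))
    v≢ε

  ·-injective : Prime p → ∀ v → v ≢ ε → ∀ m n → m < p → n < p → m · v ≡ n · v → m ≡ n
  ·-injective pr v v≢ε m n m<p n<p eq with ≤-total m n
  ... | inj₁ m≤n with d , refl ← m≤n⇒∃[o]m+o≡n m≤n = ·-gap pr v v≢ε m d n<p eq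
  ... | inj₂ n≤m with d , refl ← m≤n⇒∃[o]m+o≡n n≤m = sym (·-gap pr v v≢ε n d m<p (sym eq))

  ∈-allG : ∀ x → x ∈ˡ allG p
  ∈-allG (a , b) = ∈-cartesianProduct⁺ (∈-allFin a) (∈-allFin b)

  card-≥ : ∀ {n} (H : Subset p) (e : Fin n → G p) → Injective _≡_ _≡_ e →
           (∀ i → e i ∈ₛ H) → n ≤ card p H
  card-≥ H e e-inj e∈H = injective⇒≤ {f = index ∘ e∈list}
    (λ {i} {j} eq → e-inj (index-injective (≡.setoid (G p)) (e∈list i) (e∈list j) eq))
    where
    e∈list : ∀ i → e i ∈ˡ filterᵇ H (allG p)
    e∈list i = ∈-filter⁺ (T? ∘ H) (∈-allG (e i)) (Equivalence.from T-≡ (e∈H i))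

  ·-closed : ∀ {H v} → IsSubgroup p H → v ∈ₛ H → ∀ n → n · v ∈ₛ H
  ·-closed H-sub v∈H zero    = IsSubgroup.has-0 H-sub
  ·-closed H-sub v∈H (suc n) = IsSubgroup.⊕-closed H-sub _ _ v∈H (·-closed H-sub v∈H n)

  -- A subgroup H₁ of order p is contained in every subgroup H₂ sharing a nonzero
  -- element v with it: an x ∈ H₁ ∖ H₂ together with the p distinct multiples
  -- 0·v, …, (p-1)·v ∈ H₂ would be p + 1 distinct elements of H₁.
  order-p-⊆ : Prime p → ∀ {H₁ H₂ v} → IsSubgroup p H₁ → IsSubgroup p H₂ → card p H₁ ≡ p →
              v ≢ ε → v ∈ₛ H₁ → v ∈ₛ H₂ → ∀ x → x ∈ₛ H₁ → x ∈ₛ H₂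
  order-p-⊆ pr {H₁} {H₂} {v} H₁-sub H₂-sub |H₁|≡p v≢ε v∈H₁ v∈H₂ x x∈H₁ with H₂ x in x∈?H₂
  ... | true  = refl
  ... | false = contradiction (subst (suc p ≤_) |H₁|≡p (card-≥ H₁ e e-inj e∈H₁)) 1+n≰n
    where
    e : Fin (suc p) → G p
    e Fin.zero    = x
    e (Fin.suc k) = toℕ k · v

    x∉multiples : ∀ n → x ≢ n · v
    x∉multiples n x≡nv with trans (sym x∈?H₂) (subst (_∈ₛ H₂) (sym x≡nv) (·-closed H₂-sub v∈H₂ n))
    ... | ()

    e-inj : Injective _≡_ _≡_ e
    e-inj {Fin.zero}  {Fin.zero}  _  = refl
    e-inj {Fin.zero}  {Fin.suc l} eq = contradiction eq (x∉multiples (toℕ l))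
    e-inj {Fin.suc k} {Fin.zero}  eq = contradiction (sym eq) (x∉multiples (toℕ k))
    e-inj {Fin.suc k} {Fin.suc l} eq =
      cong Fin.suc (toℕ-injective (·-injective pr v v≢ε _ _ (toℕ<n k) (toℕ<n l) eq))

    e∈H₁ : ∀ i → e i ∈ₛ H₁
    e∈H₁ Fin.zero    = x∈H₁
    e∈H₁ (Fin.suc k) = ·-closed H₁-sub v∈H₁ (toℕ k)

  order-p-∩ : Prime p → ∀ {H₁ H₂} → IsSubgroup p H₁ → IsSubgroup p H₂ →
              card p H₁ ≡ p → card p H₂ ≡ p → ¬ (∀ x → H₁ x ≡ H₂ x) →
              ∀ v → v ∈ₛ H₁ → v ∈ₛ H₂ → v ≡ ε
  order-p-∩ pr H₁-sub H₂-sub |H₁|≡p |H₂|≡p H₁≢H₂ v v∈H₁ v∈H₂ with v ≟ ε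
  ... | yes v≡ε = v≡ε
  ... | no  v≢ε = contradiction (λ x → ⇔→≡ (mk⇔
          (order-p-⊆ pr H₁-sub H₂-sub |H₁|≡p v≢ε v∈H₁ v∈H₂ x)
          (order-p-⊆ pr H₂-sub H₁-sub |H₂|≡p v≢ε v∈H₂ v∈H₁ x)))
        H₁≢H₂

  [x∙z]-[y∙z]≡x-y : ∀ x y z → (x ∙ z) - (y ∙ z) ≡ x - y
  [x∙z]-[y∙z]≡x-y x y z = begin
    (x ∙ z) ∙ (y ∙ z) ⁻¹       ≡⟨ cong ((x ∙ z) ∙_) (⁻¹-∙-comm y z) ⟨
    (x ∙ z) ∙ (y ⁻¹ ∙ z ⁻¹)    ≡⟨ interchange x z (y ⁻¹) (z ⁻¹) ⟩
    (x - y) ∙ (z ∙ z ⁻¹)       ≡⟨ cong ((x - y) ∙_) (inverseʳ z) ⟩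
    (x - y) ∙ ε                ≡⟨ identityʳ (x - y) ⟩
    x - y                      ∎
    where open ≡-Reasoning

  x-ε≡x : ∀ x → x - ε ≡ x
  x-ε≡x x = trans (cong (x ∙_) ε⁻¹≈ε) (identityʳ x)

  module Coset {H : Subset p} (H-sub : IsSubgroup p H) where
    open IsSubgroup H-sub

    -‿closed : ∀ {x y} → x ∈ₛ H → y ∈ₛ H → x - y ∈ₛ H
    -‿closed x∈H y∈H = ⊕-closed _ _ x∈H (⊝-closed _ y∈H)

    ≈-refl : ∀ {x} → x ≈[ H ] x
    ≈-refl {x} = subst (_∈ₛ H) (sym (inverseʳ x)) has-0

    ≈-sym : ∀ {x y} → x ≈[ H ] y → y ≈[ H ] x
    ≈-sym {x} {y} x≈y = subst (_∈ₛ H) (⁻¹-anti-homo-// x y) (⊝-closed _ x≈y)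

    ≈-trans : ∀ {x y z} → x ≈[ H ] y → y ≈[ H ] z → x ≈[ H ] z
    ≈-trans {x} {y} {z} x≈y y≈z = subst (_∈ₛ H) telescope (⊕-closed _ _ x≈y y≈z)
      where
      telescope : (x - y) ∙ (y - z) ≡ x - z
      telescope = trans (assoc x (y ⁻¹) (y - z)) (cong (x ∙_) (\\-leftDividesʳ y (z ⁻¹)))

    ≈-setoid : Setoid 0ℓ 0ℓ
    ≈-setoid = record
      { Carrier       = G p
      ; _≈_           = _≈[ H ]_
      ; isEquivalence = record
        { refl = ≈-refl ; sym = ≈-sym ; trans = λ {x} {y} {z} → ≈-trans {x} {y} {z} }
      }

    module ≈-Reasoning = SetoidReasoning ≈-setoid

    ≈-∙ʳ : ∀ {x y} z → x ≈[ H ] y → x ∙ z ≈[ H ] y ∙ z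
    ≈-∙ʳ {x} {y} z = subst (_∈ₛ H) (sym ([x∙z]-[y∙z]≡x-y x y z))

    ≈-cancelʳ : ∀ {x y} z → x ∙ z ≈[ H ] y ∙ z → x ≈[ H ] y
    ≈-cancelʳ {x} {y} z = subst (_∈ₛ H) ([x∙z]-[y∙z]≡x-y x y z)

    ∈⇒≈ε : ∀ {x} → x ∈ₛ H → x ≈[ H ] ε
    ∈⇒≈ε {x} = subst (_∈ₛ H) (sym (x-ε≡x x))

    ≈ε⇒∈ : ∀ {x} → x ≈[ H ] ε → x ∈ₛ H
    ≈ε⇒∈ {x} = subst (_∈ₛ H) (x-ε≡x x)

  module Linking (D : LinkedData p) where
    open LinkedData D

    f-ε : ∀ m n → f m n ε ≈[ Gs n m ] ε
    f-ε m n = ≈-sym (≈-cancelʳ (f m n ε) (begin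
      ε ∙ f m n ε          ≡⟨ identityˡ (f m n ε) ⟩
      f m n ε              ≡⟨ cong (f m n) (identityˡ ε) ⟨
      f m n (ε ∙ ε)        ≈⟨ f-hom m n ε ε ⟩
      f m n ε ∙ f m n ε    ∎))
      where
      open Coset (Gs-subgroup n m)
      open ≈-Reasoning

    f-kernel : ∀ m n y → y ∈ₛ Gs m n → f m n y ≈[ Gs n m ] ε
    f-kernel m n y y∈G_mn = begin
      f m n y    ≈⟨ f-wd m n y ε (Coset.∈⇒≈ε (Gs-subgroup m n) y∈G_mn) ⟩
      f m n ε    ≈⟨ f-ε m n ⟩
      ε          ∎
      where open Coset.≈-Reasoning (Gs-subgroup n m)

    f-absorb : ∀ m n s t → f m n s ≈[ Gs n m ] ε → f m n (s ∙ t) ≈[ Gs n m ] f m n t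
    f-absorb m n s t fs≈ε = begin
      f m n (s ∙ t)        ≈⟨ f-hom m n s t ⟩
      f m n s ∙ f m n t    ≈⟨ ≈-∙ʳ (f m n t) fs≈ε ⟩
      ε ∙ f m n t          ≡⟨ identityˡ (f m n t) ⟩
      f m n t              ∎
      where
      open Coset (Gs-subgroup n m)
      open ≈-Reasoning

  module SchurianArgument (pr : Prime p) (D : LinkedData p) (sch : Schurian p D) where
    open LinkedData D
    open Linking D

    K : (Ω p D → Ω p D) → Set
    K = proj₁ sch

    orbit⇔basis : ∀ u v u′ v′ →
                  (Σ (Ω p D → Ω p D) λ g → K g × g u ≡ u′ × g v ≡ v′) ⇔ SameBasis p D u v u′ v′
    orbit⇔basis = proj₂ (proj₂ sch)

    shift : (Ω p D → Ω p D) → Idx p → G p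
    shift g m = proj₂ (g (m , ε))

    -- g ∈ K keeps ((m,0),(n,0)) inside its basis relation r_mn(s), where
    -- f_mn(s) ≈ 0; hence the displacements are linked by f_mn.
    shift-linked : ∀ {g} → K g → ∀ m n → shift g n ≈[ Gs n m ] f m n (shift g m)
    shift-linked {g} g∈K m n
      with Equivalence.to (orbit⇔basis (m , ε) (n , ε) (g (m , ε)) (g (n , ε))) (g , g∈K , refl , refl)
    ... | .m , .n , s , (refl , refl , ε≈f[s+ε]) , (_ , _ , gn≈f[s+gm]) = begin
      shift g n                  ≈⟨ gn≈f[s+gm] ⟩
      f m n (s ∙ shift g m)      ≈⟨ f-absorb m n s (shift g m) fs≈ε ⟩
      f m n (shift g m)          ∎
      where
      open Coset (Gs-subgroup n m)
      open ≈-Reasoning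
      fs≈ε : f m n s ≈[ Gs n m ] ε
      fs≈ε = ≈-sym (subst (λ u → ε ≈[ Gs n m ] f m n u) (identityʳ s) ε≈f[s+ε])

    -- If g fixes (a, 0), its displacements follow σ: from shift g m = s and
    -- σ_mna(s) = s′ we get shift g n = s′, since their difference lies in
    -- G_nm ∩ G_na = 0.
    shift-follows-σ : ∀ {g} → K g → ∀ a m n → n ≢ m → n ≢ a → m ≢ a → shift g a ≡ ε →
                      ∀ s s′ → shift g m ≡ s → IsSigma p D m n a s s′ → shift g n ≡ s′
    shift-follows-σ {g} g∈K a m n n≢m n≢a m≢a ga≡ε s s′ gm≡s (_ , s′∈G_na , fs≈s′) =
      x∙y⁻¹≈ε⇒x≈y (shift g n) s′
        (order-p-∩ pr (Gs-subgroup n m) (Gs-subgroup n a) (Gs-order n m n≢m) (Gs-order n a n≢a)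
          (Gs-distinct n m a m≢a) (shift g n - s′) gn≈s′ gn-s′∈G_na)
      where
      gn≈s′ : shift g n ≈[ Gs n m ] s′
      gn≈s′ = begin
        shift g n            ≈⟨ shift-linked g∈K m n ⟩
        f m n (shift g m)    ≡⟨ cong (f m n) gm≡s ⟩
        f m n s              ≈⟨ fs≈s′ ⟩
        s′                   ∎
        where open Coset.≈-Reasoning (Gs-subgroup n m)
      open Coset (Gs-subgroup n a)
      gn∈G_na : shift g n ∈ₛ Gs n a
      gn∈G_na = ≈ε⇒∈ (begin
        shift g n            ≈⟨ shift-linked g∈K a n ⟩
        f a n (shift g a)    ≡⟨ cong (f a n) ga≡ε ⟩
        f a n ε              ≈⟨ f-ε a n ⟩
        ε                    ∎)
        where open ≈-Reasoning
      gn-s′∈G_na : shift g n - s′ ∈ₛ Gs n a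
      gn-s′∈G_na = -‿closed gn∈G_na s′∈G_na

    -- For x ∈ G_ia some g ∈ K moves (i,0) to (i,x) and fixes (a,0): both pairs
    -- lie in r_ia(s) for any s with f_ia(s) ≈ 0.
    transporter : ∀ i a x → x ∈ₛ Gs i a →
                  Σ (Ω p D → Ω p D) λ g → K g × shift g i ≡ x × shift g a ≡ ε
    transporter i a x x∈G_ia =
      let g , g∈K , gi≡ix , ga≡aε = Equivalence.from (orbit⇔basis (i , ε) (a , ε) (i , x) (a , ε))
            (i , a , s , (refl , refl , in-r[s] ε has-0) , (refl , refl , in-r[s] x x∈G_ia))
      in g , g∈K , cong proj₂ gi≡ix , cong proj₂ ga≡aε
      where
      open IsSubgroup (Gs-subgroup i a) using (has-0)
      open Coset (Gs-subgroup a i)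
      s : G p
      s = proj₁ (f-surj i a ε)
      fs≈ε : f i a s ≈[ Gs a i ] ε
      fs≈ε = proj₂ (f-surj i a ε)
      in-r[s] : ∀ y → y ∈ₛ Gs i a → ε ≈[ Gs a i ] f i a (s ∙ y)
      in-r[s] y y∈G_ia = begin
        ε                ≈⟨ f-kernel i a y y∈G_ia ⟨
        f i a y          ≈⟨ f-absorb i a s y fs≈ε ⟨
        f i a (s ∙ y)    ∎
        where open ≈-Reasoning

proposition7p1 : (p : ℕ) .{{_ : NonZero p}} → Prime p → (D : LinkedData p) →
    Schurian p D →
    ∀ i j k a → Distinct4 i j k a →
    ∀ x y z w → IsSigma p D i j a x y → IsSigma p D j k a y z → IsSigma p D k i a z w →
    w ≡ x
proposition7p1 p pr D sch i j k a (i≢j , i≢k , i≢a , j≢k , j≢a , k≢a) x y z w σ-ij σ-jk σ-ki =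
  let g , g∈K , gi≡x , ga≡ε = transporter i a x (proj₁ σ-ij)
      gj≡y = shift-follows-σ g∈K a i j (i≢j ∘ sym) j≢a i≢a ga≡ε x y gi≡x σ-ij
      gk≡z = shift-follows-σ g∈K a j k (j≢k ∘ sym) k≢a j≢a ga≡ε y z gj≡y σ-jk
      gi≡w = shift-follows-σ g∈K a k i i≢k i≢a k≢a ga≡ε z w gk≡z σ-ki
  in trans (sym gi≡w) gi≡x
  where open SchurianArgument p pr D sch
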